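{- $\mathcal{C}$ cannot simultaneously contain $N_1N_1N_2$ and $N_2N_2N_1$.
   Context: Let $\mathcal{B}=\{\mathtt{A},\mathtt{C},\mathtt{G},\mathtt{T}\}$ be the genetic alphabet, and let $c\colon\mathcal{B}\to\mathcal{B}$ be the complementarity map $c(\mathtt{A})=\mathtt{T}$, $c(\mathtt{T})=\mathtt{A}$, $c(\mathtt{C})=\mathtt{G}$, $c(\mathtt{G})=\mathtt{C}$. For a codon $w=N_1N_2N_3\in\mathcal{B}^3$ its reverse complement is $\overleftarrow{c}(w)=c(N_3)c(N_2)c(N_1)$, and $\alpha(N_1N_2N_3)=N_3N_1N_2$ is the cyclic shift. A set of 3-letter words is a circular code if any concatenation of its words written on a circle can be decomposed into a concatenation of its words in a unique way. Here $\mathcal{C}$ is a maximal $C^3$ circular code: a circular code with $|\mathcal{C}|=20$, $\overleftarrow{c}(\mathcal{C})=\mathcal{C}$, and $\alpha(\mathcal{C})$ (hence also $\alpha^2(\mathcal{C})$) circular. $N_1,N_2$ are distinct bases. -}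

module Defs where

open import Data.List using (List; []; _∷_; _++_; concat; map; length)
open import Data.List.Membership.Propositional using (_∈_)
open import Data.List.Relation.Unary.All using (All)
open import Data.List.Relation.Unary.Unique.Propositional using (Unique)
open import Data.Nat using (ℕ)
open import Data.Product using (_×_)
open import Relation.Binary.PropositionalEquality using (_≡_)
open import Relation.Nullary using (¬_)

data Base : Set where
  A C G T : Base

comp : Base → Base
comp A = T
comp T = A
comp C = G
comp G = C

record Codon : Set where
  constructor cod
  field
    n₁ n₂ n₃ : Base

revComp : Codon → Codon
revComp (cod a b c) = cod (comp c) (comp b) (comp a)

shift : Codon → Codon
shift (cod a b c) = cod c a b

word : Codon → List Base
word (cod a b c) = a ∷ b ∷ c ∷ []

flat : List Codon → List Base
flat ws = concat (map word ws)

-- A code (set of codons) is represented by a duplicate-free list of codons.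
-- Set equality of two codes.
SameSet : List Codon → List Codon → Set
SameSet X Y = ∀ w → ((w ∈ X → w ∈ Y) × (w ∈ Y → w ∈ X))

-- Circular code (standard definition, Fimmel–Michel): for all n,m ≥ 1,
-- x₁,…,xₙ, y₁,…,yₘ ∈ X, p ∈ B*, s ∈ B⁺ with
--   s x₂ … xₙ p = y₁ … yₘ  and  x₁ = p s
-- one has n = m, p = ε and xᵢ = yᵢ for all i.
Circular : List Codon → Set
Circular X =
  ∀ (x₁ : Codon) (xs : List Codon) (y₁ : Codon) (ys : List Codon)
    (p s : List Base) →
  All (_∈ X) (x₁ ∷ xs) → All (_∈ X) (y₁ ∷ ys) →
  ¬ (s ≡ []) →
  word x₁ ≡ p ++ s →
  s ++ flat xs ++ p ≡ flat (y₁ ∷ ys) →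
  (p ≡ []) × (x₁ ∷ xs ≡ y₁ ∷ ys)

MaximalC3 : List Codon → Set
MaximalC3 X =
  Unique X × (length X ≡ 20) × SameSet (map revComp X) X
  × Circular X × Circular (map shift X)

module Submission where

-- The reverse complement of N₁N₁N₂ is c(N₂)c(N₁)c(N₁), whose cyclic shift is aba with
-- a = c(N₁), b = c(N₂); symmetrically N₂N₂N₁ yields bab. So α(C) would contain aba and bab,
-- but the circular word ababab factors both as (aba)(bab) and, read from its second letter,
-- as (bab)(aba), so α(C) would not be circular.

open import Defs
open import Data.List using (List; []; _∷_; map)
open import Data.List.Membership.Propositional using (_∈_)
open import Data.List.Membership.Propositional.Properties using (∈-map⁺)
open import Data.List.Relation.Unary.All using ([]; _∷_)
open import Data.Product using (_×_; _,_; proj₁)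
open import Relation.Binary.PropositionalEquality using (_≡_; refl)
open import Relation.Nullary using (¬_)

revComp-∈ : ∀ {X} → SameSet (map revComp X) X → ∀ {w} → w ∈ X → revComp w ∈ X
revComp-∈ {X} selfComp {w} w∈X = proj₁ (selfComp (revComp w)) (∈-map⁺ revComp w∈X)

¬circular-aba-bab : ∀ {Y} (a b : Base) → cod a b a ∈ Y → cod b a b ∈ Y → ¬ Circular Y
¬circular-aba-bab a b aba∈Y bab∈Y circular
  with circular (cod a b a) (cod b a b ∷ []) (cod b a b) (cod a b a ∷ [])
                (a ∷ []) (b ∷ a ∷ [])
                (aba∈Y ∷ bab∈Y ∷ []) (bab∈Y ∷ aba∈Y ∷ []) (λ ()) refl refl
... | () , _

mainTheorem2 : (X : List Codon) → MaximalC3 X → (N₁ N₂ : Base) → ¬ (N₁ ≡ N₂) →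
    ¬ ((cod N₁ N₁ N₂ ∈ X) × (cod N₂ N₂ N₁ ∈ X))
mainTheorem2 X (_ , _ , selfComp , _ , shiftCircular) N₁ N₂ _ (u∈X , v∈X) =
  ¬circular-aba-bab (comp N₁) (comp N₂) (shifted u∈X) (shifted v∈X) shiftCircular
  where
  shifted : ∀ {w} → w ∈ X → shift (revComp w) ∈ map shift X
  shifted w∈X = ∈-map⁺ shift (revComp-∈ selfComp w∈X)
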